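{- Let $m\geqslant 3$, $n\geqslant 3$ be odd integers, $m=2m_0+1$. Let $X=\{x_{i,j}\}$ be a bicentrally balanced $C_4$-face-magic projective labeling on $\mathcal{P}_{m,n}$ and let $\alpha:\{1,\ldots,m_0\}\to\{0,1\}$. Define $Z=\{z_{i,j}\}$ by, for $1\leqslant i\leqslant m_0$ and $1\leqslant j\leqslant n$, $z_{i,j}=x_{(1-\alpha(i))i+\alpha(i)(m+1-i),j}$ and $z_{m+1-i,j}=x_{\alpha(i)i+(1-\alpha(i))(m+1-i),j}$ (and $z_{m_0+1,j}=x_{m_0+1,j}$), i.e. the labels of columns $i$ and $m+1-i$ are swapped exactly when $\alpha(i)=1$. Then $Z$ is a bicentrally balanced $C_4$-face-magic projective labeling on $\mathcal{P}_{m,n}$.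
   Context: For integers $m,n\geqslant 2$, the projective grid graph $\mathcal{P}_{m,n}$ has vertex set $\{(i,j):1\leqslant i\leqslant m,\ 1\leqslant j\leqslant n\}$ and edges $(i,j)$–$(i,j+1)$ ($j\leqslant n-1$), $(i,n)$–$(m+1-i,1)$, $(i,j)$–$(i+1,j)$ ($i\leqslant m-1$), $(m,j)$–$(1,n+1-j)$, embedded naturally in the projective plane. Its 4-cycle faces are $\{(i,j),(i+1,j),(i,j+1),(i+1,j+1)\}$ ($1\leqslant i\leqslant m-1$, $1\leqslant j\leqslant n-1$), $\{(i,n),(i+1,n),(m+1-i,1),(m-i,1)\}$ ($1\leqslant i\leqslant m-1$), and $\{(m,j),(m,j+1),(1,n+1-j),(1,n-j)\}$ ($1\leqslant j\leqslant n-1$); the other two faces are digons. A $C_4$-face-magic projective labeling is a bijection $(i,j)\mapsto x_{i,j}$ onto $\{1,\ldots,mn\}$ such that every 4-cycle face has the same label sum (the $C_4$-face-magic value). For odd $m,n$ let $S(i,j)=\tfrac12 mn+\tfrac32$ if $i+j$ is even and $S(i,j)=\tfrac32 mn+\tfrac32$ if $i+j$ is odd; a $C_4$-face-magic projective labeling with value $2mn+3$ is bicentrally balanced if $x_{i,j}+x_{m+1-i,n+1-j}=S(i,j)$ for all $(i,j)$. Column $i$ means the vertices $(i,j)$, $1\leqslant j\leqslant n$. -}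

module Defs where

open import Data.Nat using (ℕ; zero; suc; _+_; _*_; _∸_; _≤_; _<_; _≤ᵇ_; _/_; _%_; _≡ᵇ_)
open import Data.Nat.Properties
open import Data.Bool using (Bool; true; false; if_then_else_)
open import Data.Product using (Σ; ∃; _×_; _,_)
open import Relation.Binary.PropositionalEquality using (_≡_)

-- A labeling of the vertices (i,j), 1 ≤ i ≤ m, 1 ≤ j ≤ n, is a function ℕ → ℕ → ℕ;
-- only its values on the grid are relevant.
Labeling : Set
Labeling = ℕ → ℕ → ℕ

InGrid : ℕ → ℕ → ℕ → ℕ → Set
InGrid m n i j = (1 ≤ i × i ≤ m) × (1 ≤ j × j ≤ n)

IsBijectiveLabeling : ℕ → ℕ → Labeling → Set
IsBijectiveLabeling m n x =
  (∀ i j → InGrid m n i j → 1 ≤ x i j × x i j ≤ m * n)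
  × (∀ i j i' j' → InGrid m n i j → InGrid m n i' j' →
       x i j ≡ x i' j' → (i ≡ i' × j ≡ j'))
  × (∀ k → 1 ≤ k → k ≤ m * n → ∃ λ i → ∃ λ j → InGrid m n i j × x i j ≡ k)

AllC4FacesSum : ℕ → ℕ → Labeling → ℕ → Set
AllC4FacesSum m n x k =
  (∀ i j → 1 ≤ i → i ≤ m ∸ 1 → 1 ≤ j → j ≤ n ∸ 1 →
     x i j + x (suc i) j + x i (suc j) + x (suc i) (suc j) ≡ k)
  × (∀ i → 1 ≤ i → i ≤ m ∸ 1 →
     x i n + x (suc i) n + x (m + 1 ∸ i) 1 + x (m ∸ i) 1 ≡ k)
  × (∀ j → 1 ≤ j → j ≤ n ∸ 1 →
     x m j + x m (suc j) + x 1 (n + 1 ∸ j) + x 1 (n ∸ j) ≡ k)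

IsC4FaceMagicProjective : ℕ → ℕ → Labeling → ℕ → Set
IsC4FaceMagicProjective m n x k = IsBijectiveLabeling m n x × AllC4FacesSum m n x k

-- S(i,j) = mn/2 + 3/2 if i+j even, 3mn/2 + 3/2 if i+j odd (m,n odd so these are integers)
S : ℕ → ℕ → ℕ → ℕ → ℕ
S m n i j = if ((i + j) % 2 ≡ᵇ 0)
              then (m * n + 3) / 2
              else (3 * (m * n) + 3) / 2

IsBicentrallyBalanced : ℕ → ℕ → Labeling → Set
IsBicentrallyBalanced m n x =
  IsC4FaceMagicProjective m n x (2 * (m * n) + 3)
  × (∀ i j → InGrid m n i j → x i j + x (m + 1 ∸ i) (n + 1 ∸ j) ≡ S m n i j)

-- α : {1,…,m0} → {0,1} encoded as Bool (true = 1); values outside 1..m0 are unused.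
colIndex : ℕ → (ℕ → Bool) → ℕ → ℕ
colIndex m0 α i =
  if i ≤ᵇ m0
    then (if α i then m + 1 ∸ i else i)
    else (if (m0 + 2) ≤ᵇ i
            then (if α (m + 1 ∸ i) then m + 1 ∸ i else i)
            else i)
  where m = 2 * m0 + 1

swapColumns : ℕ → (ℕ → Bool) → Labeling → Labeling
swapColumns m0 α x i j = x (colIndex m0 α i) j

-- Swapping columns i and m+1-i commutes with the reflection i ↦ m+1-i, so balance of Z
-- at (i,j) is balance of X at (i',j) for some i' ∈ {i, m+1-i}, and S(i',j) = S(i,j)
-- because m+1 is even.  For the square faces fix the rows j, j+1 and put
-- A(i) = x(i,j) + x(i,j+1): adjacent square faces give A(i) + A(i+1) = 2mn+3, so A is
-- 2-periodic and A(m+1-i) = A(i); a square face of Z therefore has the same two column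
-- sums as the corresponding face of X.  The faces through the twisted edges follow from
-- balance alone: each splits into two balanced pairs whose S-values have opposite parity.
module Submission where

open import Defs
open import Data.Nat
  using (ℕ; zero; suc; _+_; _*_; _∸_; _≤_; _<_; _≤ᵇ_; _/_; _%_; _≡ᵇ_; z≤n; s≤s; s≤s⁻¹; pred)
open import Data.Nat.Properties
open import Data.Nat.DivMod using ([m+n]%n≡m%n; [m+kn]%n≡m%n; m*n/n≡m)
open import Data.Nat.Tactic.RingSolver using (solve-∀)
open import Data.Bool using (Bool; true; false; not; if_then_else_)
open import Data.Bool.Properties using (not-involutive; ¬-not; T-≡)
open import Data.Product using (_×_; _,_; proj₁; proj₂)
open import Data.Sum using (inj₁; inj₂)
open import Function.Bundles using (Equivalence)
open import Relation.Binary using (tri<; tri≈; tri>)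
open import Relation.Binary.PropositionalEquality

≤ᵇ-true : ∀ {m n} → m ≤ n → (m ≤ᵇ n) ≡ true
≤ᵇ-true m≤n = Equivalence.to T-≡ (≤⇒≤ᵇ m≤n)

≤ᵇ-false : ∀ {m n} → n < m → (m ≤ᵇ n) ≡ false
≤ᵇ-false {m} {n} n<m =
  ¬-not λ m≤ᵇn → <⇒≱ n<m (≤ᵇ⇒≤ m n (Equivalence.from T-≡ m≤ᵇn))

≤pred⇒< : ∀ {i n} → 1 ≤ i → i ≤ pred n → i < n
≤pred⇒< {n = zero}  (s≤s _) ()
≤pred⇒< {n = suc _} _       i≤n = s≤s i≤n

parity-suc : ∀ r → (suc r % 2 ≡ᵇ 0) ≡ not (r % 2 ≡ᵇ 0)
parity-suc zero    = refl
parity-suc (suc r) = begin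
  (suc (suc r) % 2 ≡ᵇ 0)  ≡⟨ cong (λ k → k % 2 ≡ᵇ 0) (+-comm 2 r) ⟩
  ((r + 2) % 2 ≡ᵇ 0)      ≡⟨ cong (_≡ᵇ 0) ([m+n]%n≡m%n r 2) ⟩
  (r % 2 ≡ᵇ 0)            ≡⟨ not-involutive _ ⟨
  not (not (r % 2 ≡ᵇ 0))  ≡⟨ cong not (parity-suc r) ⟨
  not (suc r % 2 ≡ᵇ 0)    ∎
  where open ≡-Reasoning

parity-reflect : ∀ {M} k i j → M ≡ 2 * k → i ≤ M → (M ∸ i + j) % 2 ≡ (i + j) % 2
parity-reflect {M} k i j refl i≤M = begin
  (M ∸ i + j) % 2          ≡⟨ [m+kn]%n≡m%n (M ∸ i + j) i 2 ⟨
  (M ∸ i + j + i * 2) % 2  ≡⟨ cong (_% 2) shift ⟩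
  (i + j + k * 2) % 2      ≡⟨ [m+kn]%n≡m%n (i + j) k 2 ⟩
  (i + j) % 2              ∎
  where
  open ≡-Reasoning
  shift : M ∸ i + j + i * 2 ≡ i + j + k * 2
  shift = begin
    M ∸ i + j + i * 2    ≡⟨ regroup (M ∸ i) j i ⟩
    (M ∸ i + i) + (i + j) ≡⟨ cong (_+ (i + j)) (m∸n+n≡m i≤M) ⟩
    2 * k + (i + j)       ≡⟨ rotate k (i + j) ⟩
    i + j + k * 2         ∎
    where
    regroup : ∀ t j i → t + j + i * 2 ≡ (t + i) + (i + j)
    regroup = solve-∀
    rotate : ∀ k r → 2 * k + r ≡ r + k * 2
    rotate = solve-∀

if-not-+ : ∀ b (u v : ℕ) → (if b then u else v) + (if not b then u else v) ≡ u + v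
if-not-+ true  u v = refl
if-not-+ false u v = +-comm v u

halves-of-odd : ∀ p q → p ≡ suc (q * 2) → (p + 3) / 2 + (3 * p + 3) / 2 ≡ 2 * p + 3
halves-of-odd _ q refl = begin
  (suc (q * 2) + 3) / 2 + (3 * suc (q * 2) + 3) / 2
    ≡⟨ cong₂ (λ a b → a / 2 + b / 2) (lo q) (hi q) ⟩
  ((q + 2) * 2) / 2 + ((3 * q + 3) * 2) / 2
    ≡⟨ cong₂ _+_ (m*n/n≡m (q + 2) 2) (m*n/n≡m (3 * q + 3) 2) ⟩
  (q + 2) + (3 * q + 3)
    ≡⟨ total q ⟩
  2 * suc (q * 2) + 3 ∎
  where
  open ≡-Reasoning
  lo : ∀ q → suc (q * 2) + 3 ≡ (q + 2) * 2
  lo = solve-∀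
  hi : ∀ q → 3 * suc (q * 2) + 3 ≡ (3 * q + 3) * 2
  hi = solve-∀
  total : ∀ q → (q + 2) + (3 * q + 3) ≡ 2 * suc (q * 2) + 3
  total = solve-∀

S-+-S-suc : ∀ m n q → m * n ≡ suc (q * 2) → ∀ i j →
  S m n i j + S m n (suc i) j ≡ 2 * (m * n) + 3
S-+-S-suc m n q odd i j = begin
  S m n i j + S m n (suc i) j
    ≡⟨ cong (λ b → S m n i j + (if b then lo else hi)) (parity-suc (i + j)) ⟩
  S m n i j + (if not ((i + j) % 2 ≡ᵇ 0) then lo else hi)
    ≡⟨ if-not-+ ((i + j) % 2 ≡ᵇ 0) lo hi ⟩
  lo + hi
    ≡⟨ halves-of-odd (m * n) q odd ⟩
  2 * (m * n) + 3 ∎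
  where
  open ≡-Reasoning
  lo hi : ℕ
  lo = (m * n + 3) / 2
  hi = (3 * (m * n) + 3) / 2

S-sucʳ : ∀ m n i j → S m n i (suc j) ≡ S m n (suc i) j
S-sucʳ m n i j =
  cong (λ r → if r % 2 ≡ᵇ 0 then (m * n + 3) / 2 else (3 * (m * n) + 3) / 2) (+-suc i j)

S-reflect : ∀ m n {M} k i j → M ≡ 2 * k → i ≤ M → S m n (M ∸ i) j ≡ S m n i j
S-reflect m n k i j M≡2k i≤M =
  cong (λ r → if r ≡ᵇ 0 then (m * n + 3) / 2 else (3 * (m * n) + 3) / 2)
       (parity-reflect k i j M≡2k i≤M)

-- AllC4FacesSum m n x k unfolds to SquareFacesSum m n x k × TwistedFacesSum m n x k,
-- and IsBicentrallyBalanced m n x to IsC4FaceMagicProjective m n x (2mn + 3) × Bicentral m n x.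
SquareFacesSum : ℕ → ℕ → Labeling → ℕ → Set
SquareFacesSum m n x k =
  ∀ i j → 1 ≤ i → i ≤ m ∸ 1 → 1 ≤ j → j ≤ n ∸ 1 →
    x i j + x (suc i) j + x i (suc j) + x (suc i) (suc j) ≡ k

TwistedFacesSum : ℕ → ℕ → Labeling → ℕ → Set
TwistedFacesSum m n x k =
  (∀ i → 1 ≤ i → i ≤ m ∸ 1 →
     x i n + x (suc i) n + x (m + 1 ∸ i) 1 + x (m ∸ i) 1 ≡ k)
  × (∀ j → 1 ≤ j → j ≤ n ∸ 1 →
     x m j + x m (suc j) + x 1 (n + 1 ∸ j) + x 1 (n ∸ j) ≡ k)

Bicentral : ℕ → ℕ → Labeling → Set
Bicentral m n x = ∀ i j → InGrid m n i j → x i j + x (m + 1 ∸ i) (n + 1 ∸ j) ≡ S m n i j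

+-interchange : ∀ a b c d → a + b + c + d ≡ (a + c) + (b + d)
+-interchange = solve-∀

bicentral⇒twistedFacesSum : ∀ m n q → m * n ≡ suc (q * 2) → 1 ≤ m → 1 ≤ n →
  (y : Labeling) → Bicentral m n y → TwistedFacesSum m n y (2 * (m * n) + 3)
bicentral⇒twistedFacesSum m n q odd 1≤m 1≤n y bal = alongRows , alongColumns
  where
  open ≡-Reasoning
  n+1∸n≡1 : n + 1 ∸ n ≡ 1
  n+1∸n≡1 = m+n∸m≡n n 1
  m+1∸m≡1 : m + 1 ∸ m ≡ 1
  m+1∸m≡1 = m+n∸m≡n m 1
  [k+1]∸suc : ∀ k i → k + 1 ∸ suc i ≡ k ∸ i
  [k+1]∸suc k i = cong (_∸ suc i) (+-comm k 1)

  alongRows : ∀ i → 1 ≤ i → i ≤ m ∸ 1 →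
    y i n + y (suc i) n + y (m + 1 ∸ i) 1 + y (m ∸ i) 1 ≡ 2 * (m * n) + 3
  alongRows i 1≤i i≤pm = begin
    y i n + y (suc i) n + y (m + 1 ∸ i) 1 + y (m ∸ i) 1
      ≡⟨ +-interchange (y i n) (y (suc i) n) (y (m + 1 ∸ i) 1) (y (m ∸ i) 1) ⟩
    (y i n + y (m + 1 ∸ i) 1) + (y (suc i) n + y (m ∸ i) 1)
      ≡⟨ cong₂ _+_
           (subst (λ b → y i n + y (m + 1 ∸ i) b ≡ S m n i n) n+1∸n≡1
             (bal i n (i∈ , n∈)))
           (subst₂ (λ a b → y (suc i) n + y a b ≡ S m n (suc i) n) ([k+1]∸suc m i)
             n+1∸n≡1 (bal (suc i) n ((s≤s z≤n , 1+i≤m) , n∈))) ⟩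
    S m n i n + S m n (suc i) n
      ≡⟨ S-+-S-suc m n q odd i n ⟩
    2 * (m * n) + 3 ∎
    where
    1+i≤m : suc i ≤ m
    1+i≤m = ≤pred⇒< 1≤i i≤pm
    i∈ : 1 ≤ i × i ≤ m
    i∈ = 1≤i , ≤-trans (n≤1+n i) 1+i≤m
    n∈ : 1 ≤ n × n ≤ n
    n∈ = 1≤n , ≤-refl

  alongColumns : ∀ j → 1 ≤ j → j ≤ n ∸ 1 →
    y m j + y m (suc j) + y 1 (n + 1 ∸ j) + y 1 (n ∸ j) ≡ 2 * (m * n) + 3
  alongColumns j 1≤j j≤pn = begin
    y m j + y m (suc j) + y 1 (n + 1 ∸ j) + y 1 (n ∸ j)
      ≡⟨ +-interchange (y m j) (y m (suc j)) (y 1 (n + 1 ∸ j)) (y 1 (n ∸ j)) ⟩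
    (y m j + y 1 (n + 1 ∸ j)) + (y m (suc j) + y 1 (n ∸ j))
      ≡⟨ cong₂ _+_
           (subst (λ a → y m j + y a (n + 1 ∸ j) ≡ S m n m j) m+1∸m≡1
             (bal m j (m∈ , j∈)))
           (subst₂ (λ a b → y m (suc j) + y a b ≡ S m n m (suc j)) m+1∸m≡1
             ([k+1]∸suc n j) (bal m (suc j) (m∈ , (s≤s z≤n , 1+j≤n)))) ⟩
    S m n m j + S m n m (suc j)
      ≡⟨ cong (S m n m j +_) (S-sucʳ m n m j) ⟩
    S m n m j + S m n (suc m) j
      ≡⟨ S-+-S-suc m n q odd m j ⟩
    2 * (m * n) + 3 ∎
    where
    1+j≤n : suc j ≤ n
    1+j≤n = ≤pred⇒< 1≤j j≤pn
    j∈ : 1 ≤ j × j ≤ n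
    j∈ = 1≤j , ≤-trans (n≤1+n j) 1+j≤n
    m∈ : 1 ≤ m × m ≤ m
    m∈ = 1≤m , ≤-refl

data FixesOrSwaps (r c : ℕ → ℕ) (i : ℕ) : Set where
  fixes : c i ≡ i → c (r i) ≡ r i → FixesOrSwaps r c i
  swaps : c i ≡ r i → c (r i) ≡ i → FixesOrSwaps r c i

module _ {r c : ℕ → ℕ} {i : ℕ} where

  fixesOrSwaps-if : ∀ b →
    c i ≡ (if b then r i else i) → c (r i) ≡ (if b then i else r i) → FixesOrSwaps r c i
  fixesOrSwaps-if true  = swaps
  fixesOrSwaps-if false = fixes

  fixesOrSwaps-preserves : (P : ℕ → Set) → FixesOrSwaps r c i → P i → P (r i) → P (c i)
  fixesOrSwaps-preserves P (fixes ci≡i _)  Pi _   = subst P (sym ci≡i) Pi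
  fixesOrSwaps-preserves P (swaps ci≡ri _) _  Pri = subst P (sym ci≡ri) Pri

  fixesOrSwaps-involutive : FixesOrSwaps r c i → c (c i) ≡ i
  fixesOrSwaps-involutive (fixes ci≡i _)      = trans (cong c ci≡i) ci≡i
  fixesOrSwaps-involutive (swaps ci≡ri cri≡i) = trans (cong c ci≡ri) cri≡i

  fixesOrSwaps-commute : r (r i) ≡ i → FixesOrSwaps r c i → c (r i) ≡ r (c i)
  fixesOrSwaps-commute _     (fixes ci≡i cri≡ri) = trans cri≡ri (cong r (sym ci≡i))
  fixesOrSwaps-commute rri≡i (swaps ci≡ri cri≡i) =
    trans cri≡i (trans (sym rri≡i) (cong r (sym ci≡ri)))

  fixesOrSwaps-reflect : r (r i) ≡ i → FixesOrSwaps r c i → FixesOrSwaps r c (r i)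
  fixesOrSwaps-reflect rri≡i (fixes ci≡i cri≡ri) =
    fixes cri≡ri (trans (cong c rri≡i) (trans ci≡i (sym rri≡i)))
  fixesOrSwaps-reflect rri≡i (swaps ci≡ri cri≡i) =
    swaps (trans cri≡i (sym rri≡i)) (trans (cong c rri≡i) ci≡ri)

module Reflection (m : ℕ) where

  reflect : ℕ → ℕ
  reflect i = m + 1 ∸ i

  ≤⇒≤+1 : ∀ {i} → i ≤ m → i ≤ m + 1
  ≤⇒≤+1 i≤m = ≤-trans i≤m (m≤m+n m 1)

  reflect-involutive : ∀ {i} → i ≤ m → reflect (reflect i) ≡ i
  reflect-involutive i≤m = m∸[m∸n]≡n (≤⇒≤+1 i≤m)

  reflect-range : ∀ {i} → 1 ≤ i × i ≤ m → 1 ≤ reflect i × reflect i ≤ m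
  reflect-range (1≤i , i≤m) =
      m<n⇒0<n∸m (≤-<-trans i≤m (m<m+n m (s≤s z≤n)))
    , ≤-trans (∸-monoʳ-≤ (m + 1) 1≤i) (≤-reflexive (m+n∸n≡m m 1))

  +-reflect : ∀ {i} → i ≤ m → i + reflect i ≡ m + 1
  +-reflect i≤m = m+[n∸m]≡n (≤⇒≤+1 i≤m)

module ColumnSwap (m0 : ℕ) (α : ℕ → Bool) where

  open Reflection (2 * m0 + 1)

  m+1≡m0+[m0+2] : 2 * m0 + 1 + 1 ≡ m0 + (m0 + 2)
  m+1≡m0+[m0+2] = by-ring m0
    where
    by-ring : ∀ a → 2 * a + 1 + 1 ≡ a + (a + 2)
    by-ring = solve-∀

  m0≤m : m0 ≤ 2 * m0 + 1
  m0≤m = ≤-trans (m≤m+n m0 (m0 + 0)) (m≤m+n (2 * m0) 1)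

  reflect-low : ∀ {i} → i ≤ m0 → m0 + 2 ≤ reflect i
  reflect-low {i} i≤m0 =
    subst (_≤ reflect i) m+1∸m0 (∸-monoʳ-≤ (2 * m0 + 1 + 1) i≤m0)
    where
    m+1∸m0 : 2 * m0 + 1 + 1 ∸ m0 ≡ m0 + 2
    m+1∸m0 = trans (cong (_∸ m0) m+1≡m0+[m0+2]) (m+n∸m≡n m0 (m0 + 2))

  reflect-high : ∀ {i} → m0 + 2 ≤ i → reflect i ≤ m0
  reflect-high {i} m0+2≤i =
    subst (reflect i ≤_) m+1∸[m0+2] (∸-monoʳ-≤ (2 * m0 + 1 + 1) m0+2≤i)
    where
    m+1∸[m0+2] : 2 * m0 + 1 + 1 ∸ (m0 + 2) ≡ m0
    m+1∸[m0+2] = trans (cong (_∸ (m0 + 2)) m+1≡m0+[m0+2]) (m+n∸n≡m m0 (m0 + 2))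

  reflect-middle : reflect (suc m0) ≡ suc m0
  reflect-middle = trans (cong (_∸ suc m0) (by-ring m0)) (m+n∸m≡n (suc m0) (suc m0))
    where
    by-ring : ∀ a → 2 * a + 1 + 1 ≡ suc a + suc a
    by-ring = solve-∀

  colIndex-low : ∀ {i} → i ≤ m0 → colIndex m0 α i ≡ (if α i then reflect i else i)
  colIndex-low i≤m0 rewrite ≤ᵇ-true i≤m0 = refl

  colIndex-high : ∀ {i} → m0 + 2 ≤ i →
    colIndex m0 α i ≡ (if α (reflect i) then reflect i else i)
  colIndex-high m0+2≤i
    rewrite ≤ᵇ-false (<-≤-trans (m<m+n m0 (s≤s z≤n)) m0+2≤i) | ≤ᵇ-true m0+2≤i
    = refl

  colIndex-middle : colIndex m0 α (suc m0) ≡ suc m0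
  colIndex-middle
    rewrite ≤ᵇ-false (n<1+n m0) | ≤ᵇ-false (≤-reflexive (+-comm 2 m0)) = refl

  colIndex-fixesOrSwaps-low : ∀ {i} → i ≤ m0 → FixesOrSwaps reflect (colIndex m0 α) i
  colIndex-fixesOrSwaps-low {i} i≤m0 = fixesOrSwaps-if (α i) (colIndex-low i≤m0) (begin
    colIndex m0 α (reflect i)
      ≡⟨ colIndex-high (reflect-low i≤m0) ⟩
    (if α (reflect (reflect i)) then reflect (reflect i) else reflect i)
      ≡⟨ cong (λ k → if α k then k else reflect i)
              (reflect-involutive (≤-trans i≤m0 m0≤m)) ⟩
    (if α i then i else reflect i) ∎)
    where open ≡-Reasoning

  colIndex-fixesOrSwaps : ∀ {i} → i ≤ 2 * m0 + 1 → FixesOrSwaps reflect (colIndex m0 α) i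
  colIndex-fixesOrSwaps {i} i≤m with <-cmp i (suc m0)
  ... | tri< i<1+m0 _ _ = colIndex-fixesOrSwaps-low (s≤s⁻¹ i<1+m0)
  ... | tri≈ _ refl _ = fixes colIndex-middle colIndex-reflect-middle
    where
    colIndex-reflect-middle : colIndex m0 α (reflect (suc m0)) ≡ reflect (suc m0)
    colIndex-reflect-middle = begin
      colIndex m0 α (reflect (suc m0))  ≡⟨ cong (colIndex m0 α) reflect-middle ⟩
      colIndex m0 α (suc m0)            ≡⟨ colIndex-middle ⟩
      suc m0                            ≡⟨ reflect-middle ⟨
      reflect (suc m0)                  ∎
      where open ≡-Reasoning
  ... | tri> _ _ 1+m0<i =
    subst (FixesOrSwaps reflect (colIndex m0 α)) (reflect-involutive i≤m)
      (fixesOrSwaps-reflect (reflect-involutive ri≤m) (colIndex-fixesOrSwaps-low ri≤m0))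
    where
    ri≤m0 : reflect i ≤ m0
    ri≤m0 = reflect-high (≤-trans (≤-reflexive (+-comm m0 2)) 1+m0<i)
    ri≤m : reflect i ≤ 2 * m0 + 1
    ri≤m = ≤-trans ri≤m0 m0≤m

module Alternating {A : ℕ → ℕ} {K m : ℕ}
  (alternates : ∀ p → 1 ≤ p → suc p ≤ m → A p + A (suc p) ≡ K) where

  step : ∀ {p} → 1 ≤ p → 2 + p ≤ m → A (2 + p) ≡ A p
  step {p} 1≤p 2+p≤m = +-cancelˡ-≡ (A (suc p)) (A (2 + p)) (A p) (begin
    A (suc p) + A (2 + p)  ≡⟨ alternates (suc p) (s≤s z≤n) 2+p≤m ⟩
    K                      ≡⟨ alternates p 1≤p (≤-trans (n≤1+n (suc p)) 2+p≤m) ⟨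
    A p + A (suc p)        ≡⟨ +-comm (A p) (A (suc p)) ⟩
    A (suc p) + A p        ∎)
    where open ≡-Reasoning

  periodic : ∀ d {p} → 1 ≤ p → p + 2 * d ≤ m → A (p + 2 * d) ≡ A p
  periodic zero    {p} _   _ = cong A (+-identityʳ p)
  periodic (suc d) {p} 1≤p p+2[1+d]≤m = begin
    A (p + 2 * suc d)    ≡⟨ cong A shift ⟩
    A (2 + p + 2 * d)    ≡⟨ periodic d (s≤s z≤n) 2+p+2d≤m ⟩
    A (2 + p)            ≡⟨ step 1≤p (≤-trans (m≤m+n (2 + p) (2 * d)) 2+p+2d≤m) ⟩
    A p                  ∎
    where
    open ≡-Reasoning
    shift : p + 2 * suc d ≡ 2 + p + 2 * d
    shift = by-ring p d
      where
      by-ring : ∀ p d → p + 2 * suc d ≡ 2 + p + 2 * d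
      by-ring = solve-∀
    2+p+2d≤m : 2 + p + 2 * d ≤ m
    2+p+2d≤m = subst (_≤ m) shift p+2[1+d]≤m

  mirror≤ : ∀ {p q s} → 1 ≤ p → q ≤ m → p ≤ s → p + q ≡ 2 * s → A q ≡ A p
  mirror≤ {p} {q} {s} 1≤p q≤m p≤s p+q≡2s =
    trans (cong A q≡) (periodic (s ∸ p) 1≤p (subst (_≤ m) q≡ q≤m))
    where
    open ≡-Reasoning
    q≡ : q ≡ p + 2 * (s ∸ p)
    q≡ = +-cancelˡ-≡ p q (p + 2 * (s ∸ p)) (begin
      p + q                    ≡⟨ p+q≡2s ⟩
      2 * s                    ≡⟨ cong (2 *_) (m+[n∸m]≡n p≤s) ⟨
      2 * (p + (s ∸ p))        ≡⟨ by-ring p (s ∸ p) ⟩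
      p + (p + 2 * (s ∸ p))    ∎)
      where
      by-ring : ∀ p d → 2 * (p + d) ≡ p + (p + 2 * d)
      by-ring = solve-∀

  mirror : ∀ {p q s} → 1 ≤ p → 1 ≤ q → p ≤ m → q ≤ m → p + q ≡ 2 * s → A q ≡ A p
  mirror {p} {q} {s} 1≤p 1≤q p≤m q≤m p+q≡2s with ≤-total p s
  ... | inj₁ p≤s = mirror≤ 1≤p q≤m p≤s p+q≡2s
  ... | inj₂ s≤p = sym (mirror≤ 1≤q p≤m q≤s (trans (+-comm q p) p+q≡2s))
    where
    open ≤-Reasoning
    q≤s : q ≤ s
    q≤s = +-cancelˡ-≤ s q s (begin
      s + q   ≤⟨ +-monoˡ-≤ q s≤p ⟩
      p + q   ≡⟨ p+q≡2s ⟩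
      2 * s   ≡⟨ cong (s +_) (+-identityʳ s) ⟩
      s + s   ∎)

columnPairSum : Labeling → ℕ → ℕ → ℕ
columnPairSum x j i = x i j + x i (suc j)

square-face-split : ∀ (x : Labeling) i j →
  x i j + x (suc i) j + x i (suc j) + x (suc i) (suc j)
    ≡ columnPairSum x j i + columnPairSum x j (suc i)
square-face-split x i j =
  +-interchange (x i j) (x (suc i) j) (x i (suc j)) (x (suc i) (suc j))

module RowReindexing {m n s : ℕ} (m+1≡2s : m + 1 ≡ 2 * s) (c : ℕ → ℕ)
  (fixesOrSwaps : ∀ {i} → i ≤ m → FixesOrSwaps (m + 1 ∸_) c i) where

  open Reflection m

  reindex : Labeling → Labeling
  reindex x i j = x (c i) j

  c-range : ∀ {i} → 1 ≤ i × i ≤ m → 1 ≤ c i × c i ≤ m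
  c-range i∈@(_ , i≤m) =
    fixesOrSwaps-preserves (λ k → 1 ≤ k × k ≤ m) (fixesOrSwaps i≤m)
      i∈ (reflect-range i∈)

  c-involutive : ∀ {i} → i ≤ m → c (c i) ≡ i
  c-involutive i≤m = fixesOrSwaps-involutive (fixesOrSwaps i≤m)

  reindex-bijective : ∀ {x} → IsBijectiveLabeling m n x → IsBijectiveLabeling m n (reindex x)
  reindex-bijective {x} (range , injective , surjective) =
      (λ i j (i∈ , j∈) → range (c i) j (c-range i∈ , j∈))
    , (λ i j i′ j′ (i∈ , j∈) (i′∈ , j′∈) eq →
         let (ci≡ci′ , j≡j′) =
               injective (c i) j (c i′) j′ (c-range i∈ , j∈) (c-range i′∈ , j′∈) eq
         in trans (sym (c-involutive (proj₂ i∈)))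
                  (trans (cong c ci≡ci′) (c-involutive (proj₂ i′∈)))
          , j≡j′)
    , λ k 1≤k k≤mn →
         let (i , j , (i∈ , j∈) , xij≡k) = surjective k 1≤k k≤mn
         in c i , j , (c-range i∈ , j∈)
          , trans (cong (λ i′ → x i′ j) (c-involutive (proj₂ i∈))) xij≡k

  reindex-bicentral : ∀ {x} → Bicentral m n x → Bicentral m n (reindex x)
  reindex-bicentral {x} bal i j (i∈@(_ , i≤m) , j∈) = begin
    x (c i) j + x (c (reflect i)) (n + 1 ∸ j)
      ≡⟨ cong (λ k → x (c i) j + x k (n + 1 ∸ j))
              (fixesOrSwaps-commute (reflect-involutive i≤m) (fixesOrSwaps i≤m)) ⟩
    x (c i) j + x (reflect (c i)) (n + 1 ∸ j)
      ≡⟨ bal (c i) j (c-range i∈ , j∈) ⟩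
    S m n (c i) j
      ≡⟨ fixesOrSwaps-preserves (λ k → S m n k j ≡ S m n i j) (fixesOrSwaps i≤m) refl
           (S-reflect m n s i j m+1≡2s (≤⇒≤+1 i≤m)) ⟩
    S m n i j ∎
    where open ≡-Reasoning

  reindex-squareFacesSum : ∀ {x k} →
    SquareFacesSum m n x k → SquareFacesSum m n (reindex x) k
  reindex-squareFacesSum {x} {k} squares i j 1≤i i≤pm 1≤j j≤pn = begin
    x (c i) j + x (c (suc i)) j + x (c i) (suc j) + x (c (suc i)) (suc j)
      ≡⟨ square-face-split (reindex x) i j ⟩
    columnPairSum x j (c i) + columnPairSum x j (c (suc i))
      ≡⟨ cong₂ _+_ (pairSum-invariant (1≤i , ≤-trans (n≤1+n i) 1+i≤m))
                   (pairSum-invariant (s≤s z≤n , 1+i≤m)) ⟩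
    columnPairSum x j i + columnPairSum x j (suc i)
      ≡⟨ square-face-split x i j ⟨
    x i j + x (suc i) j + x i (suc j) + x (suc i) (suc j)
      ≡⟨ squares i j 1≤i i≤pm 1≤j j≤pn ⟩
    k ∎
    where
    open ≡-Reasoning
    1+i≤m : suc i ≤ m
    1+i≤m = ≤pred⇒< 1≤i i≤pm

    alternates : ∀ p → 1 ≤ p → suc p ≤ m →
      columnPairSum x j p + columnPairSum x j (suc p) ≡ k
    alternates p 1≤p 1+p≤m =
      trans (sym (square-face-split x p j)) (squares p j 1≤p (<⇒≤pred 1+p≤m) 1≤j j≤pn)

    open Alternating {A = columnPairSum x j} alternates using (mirror)

    pairSum-invariant : ∀ {p} → 1 ≤ p × p ≤ m →
      columnPairSum x j (c p) ≡ columnPairSum x j p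
    pairSum-invariant {p} p∈@(1≤p , p≤m) =
      fixesOrSwaps-preserves (λ q → columnPairSum x j q ≡ columnPairSum x j p)
        (fixesOrSwaps p≤m) refl
        (mirror {s = s} 1≤p 1≤rp p≤m rp≤m (trans (+-reflect p≤m) m+1≡2s))
      where
      1≤rp : 1 ≤ reflect p
      1≤rp = proj₁ (reflect-range p∈)
      rp≤m : reflect p ≤ m
      rp≤m = proj₂ (reflect-range p∈)

lemma24 : (m0 n0 : ℕ) → 1 ≤ m0 → 1 ≤ n0 →
    (x : Labeling) →
    IsBicentrallyBalanced (2 * m0 + 1) (2 * n0 + 1) x →
    (α : ℕ → Bool) →
    IsBicentrallyBalanced (2 * m0 + 1) (2 * n0 + 1) (swapColumns m0 α x)
lemma24 m0 n0 _ _ x ((bijective , squares , _) , bicentral) α =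
    ( reindex-bijective {x} bijective
    , reindex-squareFacesSum {x} squares
    , bicentral⇒twistedFacesSum m n (m0 * n + n0) mn-odd
        (m≤n+m 1 (2 * m0)) (m≤n+m 1 (2 * n0)) (swapColumns m0 α x) bicentral′ )
  , bicentral′
  where
  m n : ℕ
  m = 2 * m0 + 1
  n = 2 * n0 + 1

  m+1≡2[1+m0] : m + 1 ≡ 2 * suc m0
  m+1≡2[1+m0] = by-ring m0
    where
    by-ring : ∀ a → 2 * a + 1 + 1 ≡ 2 * suc a
    by-ring = solve-∀

  mn-odd : m * n ≡ suc ((m0 * n + n0) * 2)
  mn-odd = by-ring m0 n0
    where
    by-ring : ∀ a b → (2 * a + 1) * (2 * b + 1) ≡ suc ((a * (2 * b + 1) + b) * 2)
    by-ring = solve-∀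

  open RowReindexing {m} {n} {suc m0} m+1≡2[1+m0]
         (colIndex m0 α) (ColumnSwap.colIndex-fixesOrSwaps m0 α)

  bicentral′ : Bicentral m n (swapColumns m0 α x)
  bicentral′ = reindex-bicentral {x} bicentral
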